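{- Let $f:\mathbb{N}\to\mathbb{C}$ with $f(1)\neq 0$. Then $$f^{ -1\circ}=\xi\left(\frac{f}{\xi}\right)^{ -1*}\qquad\text{and}\qquad f^{ -1*}=\frac{(\xi f)^{ -1\circ}}{\xi}.$$
   Context: For $n\in\mathbb{N}$ write $n=\prod_p p^{\nu_p(n)}$. The Dirichlet convolution is $(f*g)(n)=\sum_{d\mid n}f(d)g(n/d)$ and the binomial convolution is $(f\circ g)(n)=\sum_{d\mid n}\left(\prod_p\binom{\nu_p(n)}{\nu_p(d)}\right)f(d)g(n/d)$. Both have identity $\delta$, where $\delta(1)=1$ and $\delta(n)=0$ for $n>1$. For $f$ with $f(1)\ne0$, $f^{ -1\circ}$ and $f^{ -1*}$ denote the inverses of $f$ under $\circ$ and under $*$ respectively (these exist exactly when $f(1)\ne 0$). $\xi(n)=\prod_p\nu_p(n)!$. Products and quotients of functions are pointwise. -}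

module Defs where

open import Level using (_⊔_)
open import Data.Nat as ℕ using (ℕ; zero; suc; _≤_; _!)
open import Data.Nat.Divisibility using (_∣_; _∣?_; divides)
open import Data.Nat.Primality using (Prime; prime?)
open import Data.Nat.Combinatorics using (_C_)
open import Data.List using (List; []; _∷_; foldr; map; filter; upTo)
open import Data.Nat.ListAction using (product)
open import Relation.Nullary using (¬_; yes; no)
open import Algebra.Bundles using (CommutativeRing)

ιR : ∀ {c ℓ} (R : CommutativeRing c ℓ) → ℕ → CommutativeRing.Carrier R
ιR R zero    = CommutativeRing.0# R
ιR R (suc n) = CommutativeRing._+_ R (CommutativeRing.1# R) (ιR R n)

-- A field of characteristic zero (stdlib has no Field bundle).  ℂ is an instance.
-- The inverse is total (value at 0# irrelevant), as usual in formal libraries.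
record Field0 (c ℓ : Level.Level) : Set (Level.suc (c ⊔ ℓ)) where
  field
    cring : CommutativeRing c ℓ
  open CommutativeRing cring public
  field
    _⁻¹     : Carrier → Carrier
    inverse : ∀ x → ¬ (x ≈ 0#) → (x * (x ⁻¹)) ≈ 1#
    char0   : ∀ n → ¬ (ιR cring (suc n) ≈ 0#)

  ι : ℕ → Carrier
  ι = ιR cring

-- p-adic valuation ν_p(n) (meaningful for p prime, n ≥ 1); fuel-based recursion
νAux : ℕ → ℕ → ℕ → ℕ
νAux zero    p n = 0
νAux (suc k) p n with p ∣? n
... | yes (divides q _) = suc (νAux k p q)
... | no _              = 0

ν : ℕ → ℕ → ℕ
ν p n = νAux n p n

-- primes p ≤ n (all primes dividing n, for n ≥ 1, are among these)
primesUpTo : ℕ → List ℕ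
primesUpTo n = filter prime? (upTo (suc n))

ξ : ℕ → ℕ
ξ n = product (map (λ p → (ν p n) !) (primesUpTo n))

binomW : ℕ → ℕ → ℕ
binomW n d = product (map (λ p → (ν p n) C (ν p d)) (primesUpTo n))

module FieldOps {c ℓ} (K : Field0 c ℓ) where
  open Field0 K public

  Arith : Set c
  Arith = ℕ → Carrier

  sumK : List Carrier → Carrier
  sumK = foldr _+_ 0#

  convW : (ℕ → ℕ → ℕ) → Arith → Arith → Arith
  convW w f g n = sumK (map term (map suc (upTo n)))
    where
    term : ℕ → Carrier
    term d with d ∣? n
    ... | yes (divides q _) = ι (w n d) * (f d * g q)
    ... | no _              = 0#

  _⋆_ : Arith → Arith → Arith
  f ⋆ g = convW (λ _ _ → 1) f g

  _⊚_ : Arith → Arith → Arith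
  f ⊚ g = convW binomW f g

  δ : Arith
  δ 1 = 1#
  δ _ = 0#

  IsInvDir : Arith → Arith → Set ℓ
  IsInvDir f g = ∀ n → 1 ≤ n → (f ⋆ g) n ≈ δ n

  IsInvBin : Arith → Arith → Set ℓ
  IsInvBin f g = ∀ n → 1 ≤ n → (f ⊚ g) n ≈ δ n

  ξmul : Arith → Arith
  ξmul f n = ι (ξ n) * f n

  ξdiv : Arith → Arith
  ξdiv f n = f n * (ι (ξ n) ⁻¹)

{-# OPTIONS --safe #-}
-- Since ν_p is additive on products and C(a+b, a) · a! · b! = (a+b)!, every divisor d of n gives
-- ξ(n) = (∏_p C(ν_p n, ν_p d)) · ξ(d) · ξ(n/d).  Summed over d this reads f ∘ g = ξ · ((f/ξ) * (g/ξ)),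
-- so a binomial inverse g of f yields the Dirichlet inverse g/ξ of f/ξ.  Both identities then follow
-- from uniqueness of Dirichlet inverses, the second after replacing f by ξf.
module Submission where

open import Defs
open import Level using (Level)
open import Data.Nat using (ℕ; _≤_)
open import Data.Product using (_×_; _,_)
open import Relation.Nullary using (¬_)

module Valuation where
  open import Data.Nat
  open import Data.Nat.Properties
  open import Data.Nat.Divisibility
  open import Data.Nat.DivMod using (m/n*n≡m)
  open import Data.Nat.Primality
  open import Data.Nat.Combinatorics
  open import Data.Nat.ListAction using (product)
  open import Data.Nat.ListAction.Properties using (product-++; product≢0)
  open import Data.List using ([]; _∷_; map; filter; upTo; _++_; [_])
  open import Data.List.Properties using (filter-++; upTo-∷ʳ; map-++; map-cong-local)
  open import Data.List.Relation.Unary.All as All using (universal)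
  open import Data.List.Relation.Unary.All.Properties using (all-filter; map⁺)
  open import Data.Sum using (inj₁; inj₂)
  open import Function using (_∘′_)
  open import Relation.Binary.PropositionalEquality hiding ([_])
  open import Relation.Nullary using (yes; no; contradiction)
  open import Algebra.Properties.CommutativeSemigroup *-commutativeSemigroup using (interchange)

  quotient-pos : ∀ {n q p} → 1 ≤ n → n ≡ q * p → 1 ≤ q
  quotient-pos {q = zero}  1≤n refl = 1≤n
  quotient-pos {q = suc q} _   _    = s≤s z≤n

  quotient< : ∀ {n q p} → 1 ≤ n → 2 ≤ p → n ≡ q * p → q < n
  quotient< {n} {q} {p} 1≤n 2≤p n≡qp = begin-strict
    q      <⟨ m<m*n q p {{>-nonZero (quotient-pos 1≤n n≡qp)}} 2≤p ⟩
    q * p  ≡⟨ sym n≡qp ⟩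
    n      ∎
    where open ≤-Reasoning

  νAux-fuel : ∀ {p} → 2 ≤ p → ∀ k k′ n → 1 ≤ n → n ≤ k → n ≤ k′ → νAux k p n ≡ νAux k′ p n
  νAux-fuel     2≤p zero    _        _ 1≤n n≤0 _   = contradiction n≤0 (<⇒≱ 1≤n)
  νAux-fuel     2≤p (suc k) zero     _ 1≤n _   n≤0 = contradiction n≤0 (<⇒≱ 1≤n)
  νAux-fuel {p} 2≤p (suc k) (suc k′) n 1≤n n≤k n≤k′ with p ∣? n
  ... | yes (divides q n≡qp) = cong suc (νAux-fuel 2≤p k k′ q (quotient-pos 1≤n n≡qp)
                                 (≤-pred (≤-trans q<n n≤k)) (≤-pred (≤-trans q<n n≤k′)))
    where
    q<n : q < n
    q<n = quotient< 1≤n 2≤p n≡qp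
  ... | no _ = refl

  ν-∣ : ∀ {p n q} → 2 ≤ p → 1 ≤ n → n ≡ q * p → ν p n ≡ suc (ν p q)
  ν-∣ {p} {suc m} {q} 2≤p 1≤n n≡qp with p ∣? suc m
  ... | yes (divides q′ n≡q′p) = cong suc (begin
        νAux m p q′  ≡⟨ cong (νAux m p) (*-cancelʳ-≡ q′ q p {{>-nonZero (≤-trans (s≤s z≤n) 2≤p)}}
                          (trans (sym n≡q′p) n≡qp)) ⟩
        νAux m p q   ≡⟨ νAux-fuel 2≤p m q q (quotient-pos 1≤n n≡qp)
                          (≤-pred (quotient< 1≤n 2≤p n≡qp)) ≤-refl ⟩
        ν p q        ∎)
    where open ≡-Reasoning
  ... | no p∤n = contradiction (divides q n≡qp) p∤n

  ν-∤ : ∀ {p n} → ¬ p ∣ n → ν p n ≡ 0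
  ν-∤ {p} {zero}  _   = refl
  ν-∤ {p} {suc m} p∤n with p ∣? suc m
  ... | yes p∣n = contradiction p∣n p∤n
  ... | no _    = refl

  ν-< : ∀ {p n} → n < p → ν p n ≡ 0
  ν-< {n = zero}  _   = refl
  ν-< {n = suc m} n<p = ν-∤ (λ p∣n → <⇒≱ n<p (∣⇒≤ p∣n))

  ν-* : ∀ {p} → Prime p → ∀ {d q} → 1 ≤ d → 1 ≤ q → ν p (d * q) ≡ ν p d + ν p q
  ν-* {p} pp {d} {q} = go (d + q) ≤-refl
    where
    open ≡-Reasoning
    2≤p : 2 ≤ p
    2≤p = nonTrivial⇒n>1 p {{prime⇒nonTrivial pp}}

    go : ∀ s {d q} → d + q ≤ s → 1 ≤ d → 1 ≤ q → ν p (d * q) ≡ ν p d + ν p q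
    go zero    {d} {q} d+q≤0 1≤d 1≤q = contradiction (≤-trans 1≤d (m≤m+n d q)) (≤⇒≯ d+q≤0)
    go (suc s) {d} {q} d+q≤s 1≤d 1≤q with p ∣? d | p ∣? q
    ... | yes (divides d′ d≡d′p) | _ = begin
        ν p (d * q)          ≡⟨ ν-∣ {q = d′ * q} 2≤p (*-mono-≤ 1≤d 1≤q) dq≡d′qp ⟩
        suc (ν p (d′ * q))   ≡⟨ cong suc (go s d′+q≤s (quotient-pos 1≤d d≡d′p) 1≤q) ⟩
        suc (ν p d′ + ν p q) ≡⟨ cong (_+ ν p q) (ν-∣ {q = d′} 2≤p 1≤d d≡d′p) ⟨
        ν p d + ν p q        ∎
      where
      dq≡d′qp : d * q ≡ d′ * q * p
      dq≡d′qp = trans (cong (_* q) d≡d′p) (trans (*-assoc d′ p q)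
                  (trans (cong (d′ *_) (*-comm p q)) (sym (*-assoc d′ q p))))
      d′+q≤s : d′ + q ≤ s
      d′+q≤s = ≤-pred (≤-trans (+-monoˡ-< q (quotient< 1≤d 2≤p d≡d′p)) d+q≤s)
    ... | no _ | yes (divides q′ q≡q′p) = begin
        ν p (d * q)          ≡⟨ ν-∣ {q = d * q′} 2≤p (*-mono-≤ 1≤d 1≤q) dq≡dq′p ⟩
        suc (ν p (d * q′))   ≡⟨ cong suc (go s d+q′≤s 1≤d (quotient-pos 1≤q q≡q′p)) ⟩
        suc (ν p d + ν p q′) ≡⟨ +-suc (ν p d) (ν p q′) ⟨
        ν p d + suc (ν p q′) ≡⟨ cong (ν p d +_) (ν-∣ {q = q′} 2≤p 1≤q q≡q′p) ⟨
        ν p d + ν p q        ∎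
      where
      dq≡dq′p : d * q ≡ d * q′ * p
      dq≡dq′p = trans (cong (d *_) q≡q′p) (sym (*-assoc d q′ p))
      d+q′≤s : d + q′ ≤ s
      d+q′≤s = ≤-pred (≤-trans (+-monoʳ-< d (quotient< 1≤q 2≤p q≡q′p)) d+q≤s)
    ... | no p∤d | no p∤q = begin
        ν p (d * q)   ≡⟨ ν-∤ p∤dq ⟩
        0             ≡⟨ cong₂ _+_ (ν-∤ p∤d) (ν-∤ p∤q) ⟨
        ν p d + ν p q ∎
      where
      p∤dq : ¬ p ∣ d * q
      p∤dq p∣dq with euclidsLemma d q pp p∣dq
      ... | inj₁ p∣d = p∤d p∣d
      ... | inj₂ p∣q = p∤q p∣q

  [m+n]Cm*[m!*n!]≡[m+n]! : ∀ m n → ((m + n) C m) * (m ! * n !) ≡ (m + n) !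
  [m+n]Cm*[m!*n!]≡[m+n]! m n = begin
    ((m + n) C m) * (m ! * n !)             ≡⟨ cong (λ k → ((m + n) C m) * (m ! * k !)) (m+n∸m≡n m n) ⟨
    ((m + n) C m) * (m ! * (m + n ∸ m) !)    ≡⟨ cong (_* (m ! * (m + n ∸ m) !)) (nCk≡n!/k![n-k]! (m≤m+n m n)) ⟩
    ((m + n) ! / (m ! * (m + n ∸ m) !)) {{m !* (m + n ∸ m) !≢0}} * (m ! * (m + n ∸ m) !)
                                             ≡⟨ m/n*n≡m {{m !* (m + n ∸ m) !≢0}} (k![n∸k]!∣n! (m≤m+n m n)) ⟩
    (m + n) !                                ∎
    where open ≡-Reasoning

  product-map-* : ∀ (F G : ℕ → ℕ) xs → product (map (λ x → F x * G x) xs) ≡ product (map F xs) * product (map G xs)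
  product-map-* F G []       = refl
  product-map-* F G (x ∷ xs) = trans (cong (F x * G x *_) (product-map-* F G xs))
                                     (interchange (F x) (G x) (product (map F xs)) (product (map G xs)))

  prodPrimes : ℕ → (ℕ → ℕ) → ℕ
  prodPrimes N F = product (map F (primesUpTo N))

  prodPrimes-suc : ∀ F N → (Prime (suc N) → F (suc N) ≡ 1) → prodPrimes (suc N) F ≡ prodPrimes N F
  prodPrimes-suc F N F[1+N]≡1 = begin
      product (map F (primesUpTo (suc N)))                         ≡⟨ cong (product ∘′ map F) primesUpTo-suc ⟩
      product (map F (primesUpTo N ++ filter prime? [ suc N ]))    ≡⟨ cong product (map-++ F (primesUpTo N) _) ⟩
      product (map F (primesUpTo N) ++ map F (filter prime? [ suc N ])) ≡⟨ product-++ (map F (primesUpTo N)) _ ⟩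
      prodPrimes N F * product (map F (filter prime? [ suc N ]))  ≡⟨ cong (prodPrimes N F *_) last≡1 ⟩
      prodPrimes N F * 1                                           ≡⟨ *-identityʳ _ ⟩
      prodPrimes N F                                               ∎
    where
    open ≡-Reasoning
    primesUpTo-suc : primesUpTo (suc N) ≡ primesUpTo N ++ filter prime? [ suc N ]
    primesUpTo-suc = trans (cong (filter prime?) (sym (upTo-∷ʳ (suc N))))
                           (filter-++ prime? (upTo (suc N)) [ suc N ])
    last≡1 : product (map F (filter prime? [ suc N ])) ≡ 1
    last≡1 with prime? (suc N)
    ... | yes pp = trans (*-identityʳ _) (F[1+N]≡1 pp)
    ... | no _   = refl

  prodPrimes-extend : ∀ F {M N} → M ≤ N → (∀ {p} → Prime p → M < p → F p ≡ 1) → prodPrimes N F ≡ prodPrimes M F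
  prodPrimes-extend F {M} M≤N F≡1 = go (≤⇒≤′ M≤N)
    where
    go : ∀ {N} → M ≤′ N → prodPrimes N F ≡ prodPrimes M F
    go ≤′-refl            = refl
    go (≤′-step {N} M≤′N) = trans (prodPrimes-suc F N (λ pp → F≡1 pp (s≤s (≤′⇒≤ M≤′N)))) (go M≤′N)

  ξ-nonZero : ∀ n → NonZero (ξ n)
  ξ-nonZero n = product≢0 (map⁺ (universal (λ p → ν p n !≢0) (primesUpTo n)))

  ξ≡prodPrimes : ∀ {m N} → m ≤ N → ξ m ≡ prodPrimes N (λ p → ν p m !)
  ξ≡prodPrimes m≤N = sym (prodPrimes-extend _ m≤N (λ _ m<p → cong _! (ν-< m<p)))

  binomW*ξ*ξ≡ξ : ∀ {n} d q → 1 ≤ n → n ≡ q * d → binomW n d * (ξ d * ξ q) ≡ ξ n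
  binomW*ξ*ξ≡ξ {n} d q 1≤n n≡qd = begin
    binomW n d * (ξ d * ξ q)                   ≡⟨ cong₂ (λ x y → binomW n d * (x * y)) (ξ≡prodPrimes d≤n) (ξ≡prodPrimes q≤n) ⟩
    prodPrimes n B * (prodPrimes n D * prodPrimes n Q) ≡⟨ cong (prodPrimes n B *_) (product-map-* D Q (primesUpTo n)) ⟨
    prodPrimes n B * prodPrimes n (λ p → D p * Q p) ≡⟨ product-map-* B (λ p → D p * Q p) (primesUpTo n) ⟨
    prodPrimes n (λ p → B p * (D p * Q p))     ≡⟨ cong product (map-cong-local (All.map factorial-split (all-filter prime? (upTo (suc n))))) ⟩
    ξ n                                        ∎
    where
    open ≡-Reasoning
    n≡dq : n ≡ d * q
    n≡dq = trans n≡qd (*-comm q d)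
    1≤q : 1 ≤ q
    1≤q = quotient-pos 1≤n n≡qd
    1≤d : 1 ≤ d
    1≤d = quotient-pos 1≤n n≡dq
    d≤n : d ≤ n
    d≤n = subst (d ≤_) (sym n≡qd) (m≤n*m d q {{>-nonZero 1≤q}})
    q≤n : q ≤ n
    q≤n = subst (q ≤_) (sym n≡dq) (m≤n*m q d {{>-nonZero 1≤d}})
    B D Q : ℕ → ℕ
    B p = ν p n C ν p d
    D p = ν p d !
    Q p = ν p q !
    factorial-split : ∀ {p} → Prime p → B p * (D p * Q p) ≡ ν p n !
    factorial-split {p} pp rewrite trans (cong (ν p) n≡dq) (ν-* pp 1≤d 1≤q) =
      [m+n]Cm*[m!*n!]≡[m+n]! (ν p d) (ν p q)

open Valuation

module Convolution {c ℓ} (K : Field0 c ℓ) where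
  open import Data.Nat as ℕ using (zero; suc; _<_; z≤n; s≤s; NonZero)
  import Data.Nat.Properties as ℕ
  open import Data.Nat.Divisibility using (_∣?_; divides; 1∣_)
  open import Data.Nat.Induction using (<-rec)
  open import Data.List using (map; upTo; applyUpTo)
  open import Data.List.Relation.Unary.All using (All; []; _∷_; universal)
  open import Data.List.Relation.Unary.All.Properties using (map⁺; applyUpTo⁺₂)
  import Relation.Binary.PropositionalEquality as ≡
  open import Relation.Nullary using (yes; no; contradiction)
  import Algebra.Solver.CommutativeMonoid as CommutativeMonoidSolver

  open FieldOps K
  open import Relation.Binary.Reasoning.Setoid setoid
  open import Algebra.Properties.AbelianGroup +-abelianGroup using () renaming (∙-cancelʳ to +-cancelʳ)
  open CommutativeMonoidSolver *-commutativeMonoid using (solve; _⊜_; _⊕_; id)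

  ι-+ : ∀ m n → ι (m ℕ.+ n) ≈ ι m + ι n
  ι-+ zero    n = sym (+-identityˡ _)
  ι-+ (suc m) n = trans (+-congˡ (ι-+ m n)) (sym (+-assoc _ _ _))

  ι-* : ∀ m n → ι (m ℕ.* n) ≈ ι m * ι n
  ι-* zero    n = sym (zeroˡ _)
  ι-* (suc m) n = begin
    ι (n ℕ.+ m ℕ.* n)        ≈⟨ ι-+ n (m ℕ.* n) ⟩
    ι n + ι (m ℕ.* n)        ≈⟨ +-cong (sym (*-identityˡ _)) (ι-* m n) ⟩
    1# * ι n + ι m * ι n     ≈⟨ distribʳ _ _ _ ⟨
    (1# + ι m) * ι n         ∎

  ι-1 : ι 1 ≈ 1#
  ι-1 = +-identityʳ 1#

  ι-nonZero : ∀ m → .{{NonZero m}} → ¬ ι m ≈ 0#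
  ι-nonZero (suc m) = char0 m

  1≉0 : ¬ 1# ≈ 0#
  1≉0 1≈0 = char0 0 (trans ι-1 1≈0)

  *-cancelˡ : ∀ {x y z} → ¬ x ≈ 0# → x * y ≈ x * z → y ≈ z
  *-cancelˡ {x} {y} {z} x≉0 xy≈xz = begin
    y                  ≈⟨ *-identityˡ y ⟨
    1# * y             ≈⟨ *-congʳ (trans (*-comm _ _) (inverse x x≉0)) ⟨
    (x ⁻¹ * x) * y     ≈⟨ *-assoc _ _ _ ⟩
    x ⁻¹ * (x * y)     ≈⟨ *-congˡ xy≈xz ⟩
    x ⁻¹ * (x * z)     ≈⟨ *-assoc _ _ _ ⟨
    (x ⁻¹ * x) * z     ≈⟨ *-congʳ (trans (*-comm _ _) (inverse x x≉0)) ⟩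
    1# * z             ≈⟨ *-identityˡ z ⟩
    z                  ∎

  x*y≉0 : ∀ {x y} → ¬ x ≈ 0# → ¬ y ≈ 0# → ¬ x * y ≈ 0#
  x*y≉0 x≉0 y≉0 xy≈0 = y≉0 (*-cancelˡ x≉0 (trans xy≈0 (sym (zeroʳ _))))

  x⁻¹≉0 : ∀ {x} → ¬ x ≈ 0# → ¬ x ⁻¹ ≈ 0#
  x⁻¹≉0 {x} x≉0 x⁻¹≈0 = 1≉0 (trans (sym (inverse x x≉0)) (trans (*-congˡ x⁻¹≈0) (zeroʳ x)))

  x*[y*x⁻¹]≈y : ∀ {x} y → ¬ x ≈ 0# → x * (y * x ⁻¹) ≈ y
  x*[y*x⁻¹]≈y {x} y x≉0 = begin
    x * (y * x ⁻¹)   ≈⟨ solve 3 (λ a b c → a ⊕ (b ⊕ c) ⊜ b ⊕ (a ⊕ c)) refl x y (x ⁻¹) ⟩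
    y * (x * x ⁻¹)   ≈⟨ *-congˡ (inverse x x≉0) ⟩
    y * 1#           ≈⟨ *-identityʳ y ⟩
    y                ∎

  ι-ξ-nonZero : ∀ n → ¬ ι (ξ n) ≈ 0#
  ι-ξ-nonZero n = ι-nonZero (ξ n) {{ξ-nonZero n}}

  ξmul-ξdiv : ∀ f n → ι (ξ n) * ξdiv f n ≈ f n
  ξmul-ξdiv f n = x*[y*x⁻¹]≈y (f n) (ι-ξ-nonZero n)

  ξdiv-ξmul : ∀ f n → ξdiv (ξmul f) n ≈ f n
  ξdiv-ξmul f n = trans (*-assoc _ _ _) (x*[y*x⁻¹]≈y (f n) (ι-ξ-nonZero n))

  ι-ξ-split : ∀ {n} d q → 1 ≤ n → n ≡.≡ q ℕ.* d → ι (ξ n) ≈ ι (binomW n d) * (ι (ξ d) * ι (ξ q))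
  ι-ξ-split {n} d q 1≤n n≡qd = begin
    ι (ξ n)                               ≡⟨ ≡.cong ι (binomW*ξ*ξ≡ξ d q 1≤n n≡qd) ⟨
    ι (binomW n d ℕ.* (ξ d ℕ.* ξ q))      ≈⟨ ι-* (binomW n d) _ ⟩
    ι (binomW n d) * ι (ξ d ℕ.* ξ q)      ≈⟨ *-congˡ (ι-* (ξ d) (ξ q)) ⟩
    ι (binomW n d) * (ι (ξ d) * ι (ξ q))  ∎

  ξ*-cancel-δ : ∀ {n x} → 1 ≤ n → ι (ξ n) * x ≈ δ n → x ≈ δ n
  ξ*-cancel-δ {suc zero}    _ ξx≈δ = *-cancelˡ (ι-ξ-nonZero 1) (trans ξx≈δ (sym (trans (*-identityʳ _) ι-1)))
  ξ*-cancel-δ {suc (suc n)} _ ξx≈δ = *-cancelˡ (ι-ξ-nonZero (2 ℕ.+ n)) (trans ξx≈δ (sym (zeroʳ _)))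

  -- The summand of convW is local to its definition; unification recovers it.
  divisorTerm : (ℕ → ℕ → ℕ) → Arith → Arith → ℕ → ℕ → Carrier
  divisorTerm w f g n = summand (convW w f g n) ≡.refl
    where
    summand : ∀ {T : ℕ → Carrier} x → x ≡.≡ sumK (map T (map suc (upTo n))) → ℕ → Carrier
    summand {T} _ _ = T

  divisorTerm-1 : ∀ w f g n → divisorTerm w f g n 1 ≈ ι (w n 1) * (f 1 * g n)
  divisorTerm-1 w f g n with 1 ∣? n
  ... | yes (divides q n≡q*1) = reflexive (≡.cong (λ k → ι (w n 1) * (f 1 * g k))
                                  (≡.trans (≡.sym (ℕ.*-identityʳ q)) (≡.sym n≡q*1)))
  ... | no 1∤n = contradiction (1∣ n) 1∤n

  divisorTerm-scale : ∀ w w′ f g f′ g′ n d k →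
    (∀ q → n ≡.≡ q ℕ.* d → ι (w n d) * (f d * g q) ≈ k * (ι (w′ n d) * (f′ d * g′ q))) →
    divisorTerm w f g n d ≈ k * divisorTerm w′ f′ g′ n d
  divisorTerm-scale w w′ f g f′ g′ n d k scale with d ∣? n
  ... | yes (divides q n≡qd) = scale q n≡qd
  ... | no _                 = sym (zeroʳ k)

  sumK-scale : ∀ {T T′ : ℕ → Carrier} k {xs} → All (λ x → T x ≈ k * T′ x) xs →
               sumK (map T xs) ≈ k * sumK (map T′ xs)
  sumK-scale k []       = sym (zeroʳ k)
  sumK-scale k (p ∷ ps) = trans (+-cong p (sumK-scale k ps)) (sym (distribˡ _ _ _))

  convW-scale : ∀ w w′ f g f′ g′ n k →
    (∀ d q → n ≡.≡ q ℕ.* d → ι (w n d) * (f d * g q) ≈ k * (ι (w′ n d) * (f′ d * g′ q))) →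
    convW w f g n ≈ k * convW w′ f′ g′ n
  convW-scale w w′ f g f′ g′ n k scale =
    sumK-scale k (universal (λ d → divisorTerm-scale w w′ f g f′ g′ n d k (scale d)) (map suc (upTo n)))

  ⋆-congˡ : ∀ {f f′} g → (∀ d → f d ≈ f′ d) → ∀ n → (f ⋆ g) n ≈ (f′ ⋆ g) n
  ⋆-congˡ {f} {f′} g f≈f′ n = trans (convW-scale _ _ f g f′ g n 1# termwise) (*-identityˡ _)
    where
    termwise : ∀ d q → n ≡.≡ q ℕ.* d → ι 1 * (f d * g q) ≈ 1# * (ι 1 * (f′ d * g q))
    termwise d _ _ = trans (*-congˡ (*-congʳ (f≈f′ d))) (sym (*-identityˡ _))

  -- The divisor d = 1 isolates f 1 * g n; every other summand involves g only below n.
  ⋆-inverse-unique : ∀ {f g h} → ¬ f 1 ≈ 0# → IsInvDir f g → IsInvDir f h → ∀ n → 1 ≤ n → g n ≈ h n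
  ⋆-inverse-unique {f} {g} {h} f1≉0 f⋆g≈δ f⋆h≈δ = <-rec (λ n → 1 ≤ n → g n ≈ h n) step
    where
    step : ∀ n → (∀ {m} → m < n → 1 ≤ m → g m ≈ h m) → 1 ≤ n → g n ≈ h n
    step (suc m) ih 1≤n = *-cancelˡ f1≉0 (+-cancelʳ (rest h) _ _ (begin
      f 1 * g n + rest h   ≈⟨ +-congˡ rest-agree ⟨
      f 1 * g n + rest g   ≈⟨ head-split g ⟨
      (f ⋆ g) n            ≈⟨ f⋆g≈δ n 1≤n ⟩
      δ n                  ≈⟨ f⋆h≈δ n 1≤n ⟨
      (f ⋆ h) n            ≈⟨ head-split h ⟩
      f 1 * h n + rest h   ∎))
      where
      n : ℕ
      n = suc m
      one : ℕ → ℕ → ℕ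
      one _ _ = 1
      rest : Arith → Carrier
      rest k = sumK (map (divisorTerm one f k n) (map suc (applyUpTo suc m)))
      head-split : ∀ k → (f ⋆ k) n ≈ f 1 * k n + rest k
      head-split k = +-congʳ (trans (divisorTerm-1 one f k n) (trans (*-congʳ ι-1) (*-identityˡ _)))
      termwise : ∀ i q → n ≡.≡ q ℕ.* suc (suc i) →
                 ι 1 * (f (2 ℕ.+ i) * g q) ≈ 1# * (ι 1 * (f (2 ℕ.+ i) * h q))
      termwise i q n≡qd = trans (*-congˡ (*-congˡ (ih (quotient< 1≤n (s≤s (s≤s z≤n)) n≡qd)
                                                      (quotient-pos 1≤n n≡qd))))
                                (sym (*-identityˡ _))
      rest-agree : rest g ≈ rest h
      rest-agree = trans (sumK-scale 1# (map⁺ (applyUpTo⁺₂ suc m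
                     (λ i → divisorTerm-scale one one f g f h n (2 ℕ.+ i) 1# (termwise i)))))
                   (*-identityˡ _)

  ⊚≈ξ*ξdiv⋆ξdiv : ∀ f g {n} → 1 ≤ n → (f ⊚ g) n ≈ ι (ξ n) * (ξdiv f ⋆ ξdiv g) n
  ⊚≈ξ*ξdiv⋆ξdiv f g {n} 1≤n = convW-scale _ _ f g (ξdiv f) (ξdiv g) n (ι (ξ n)) termwise
    where
    termwise : ∀ d q → n ≡.≡ q ℕ.* d →
               ι (binomW n d) * (f d * g q) ≈ ι (ξ n) * (ι 1 * (ξdiv f d * ξdiv g q))
    termwise d q n≡qd = sym (begin
      ι (ξ n) * (ι 1 * ((F * X ⁻¹) * (G * Y ⁻¹)))    ≈⟨ *-cong (ι-ξ-split d q 1≤n n≡qd) (*-congʳ ι-1) ⟩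
      (B * (X * Y)) * (1# * ((F * X ⁻¹) * (G * Y ⁻¹)))
        ≈⟨ solve 7 (λ b x y f g x′ y′ → (b ⊕ (x ⊕ y)) ⊕ (id ⊕ ((f ⊕ x′) ⊕ (g ⊕ y′)))
                                   ⊜ (b ⊕ (f ⊕ g)) ⊕ ((x ⊕ x′) ⊕ (y ⊕ y′))) refl B X Y F G (X ⁻¹) (Y ⁻¹) ⟩
      (B * (F * G)) * ((X * X ⁻¹) * (Y * Y ⁻¹))      ≈⟨ *-congˡ (*-cong (inverse X (ι-ξ-nonZero d)) (inverse Y (ι-ξ-nonZero q))) ⟩
      (B * (F * G)) * (1# * 1#)                      ≈⟨ trans (*-congˡ (*-identityˡ 1#)) (*-identityʳ _) ⟩
      B * (F * G)                                    ∎)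
      where
      B X Y F G : Carrier
      B = ι (binomW n d)
      X = ι (ξ d)
      Y = ι (ξ q)
      F = f d
      G = g q

  ⊚-inverse⇒⋆-inverse-ξdiv : ∀ {f g} → IsInvBin f g → IsInvDir (ξdiv f) (ξdiv g)
  ⊚-inverse⇒⋆-inverse-ξdiv {f} {g} f⊚g≈δ n 1≤n =
    ξ*-cancel-δ 1≤n (trans (sym (⊚≈ξ*ξdiv⋆ξdiv f g 1≤n)) (f⊚g≈δ n 1≤n))

theorem2p2 : ∀ {c ℓ : Level} (K : Field0 c ℓ) → let open FieldOps K in
    (f : ℕ → Carrier) → ¬ (f 1 ≈ 0#) →
    (∀ (g h : ℕ → Carrier) → IsInvBin f g → IsInvDir (ξdiv f) h →
       ∀ n → 1 ≤ n → g n ≈ ι (ξ n) * h n)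
    ×
    (∀ (g h : ℕ → Carrier) → IsInvDir f g → IsInvBin (ξmul f) h →
       ∀ n → 1 ≤ n → g n ≈ h n * (ι (ξ n) ⁻¹))
theorem2p2 K f f1≉0 =
    (λ g h f⊚g≈δ f/ξ⋆h≈δ n 1≤n →
       trans (sym (ξmul-ξdiv g n))
             (*-congˡ (⋆-inverse-unique f/ξ[1]≉0 (⊚-inverse⇒⋆-inverse-ξdiv f⊚g≈δ) f/ξ⋆h≈δ n 1≤n)))
  , (λ g h f⋆g≈δ ξf⊚h≈δ →
       ⋆-inverse-unique f1≉0 f⋆g≈δ (λ n 1≤n →
         trans (⋆-congˡ (ξdiv h) (λ d → sym (ξdiv-ξmul f d)) n)
               (⊚-inverse⇒⋆-inverse-ξdiv ξf⊚h≈δ n 1≤n)))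
  where
  open FieldOps K
  open Convolution K
  f/ξ[1]≉0 : ¬ ξdiv f 1 ≈ 0#
  f/ξ[1]≉0 = x*y≉0 f1≉0 (x⁻¹≉0 (ι-ξ-nonZero 1))
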